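{- Let $G$ be a simple graph with $n$ vertices and $m$ edges, where $m\ge n-1$, and let $k$ be an integer with $3\le k\le n$. If $\frac{2m}{n}$ is an integer, then $\lambda_k(G)\leq \frac{2m}{n}-1$.
   Context: All graphs are finite, simple and undirected. For a graph $G$ and a vertex set $S\subseteq V(G)$ with $|S|\ge 2$, an $S$-Steiner tree is a subgraph of $G$ which is a tree and contains every vertex of $S$. $\lambda(S)$ denotes the maximum number of pairwise edge-disjoint $S$-Steiner trees in $G$. For an integer $k$ with $2\le k\le |V(G)|$, the generalized $k$-edge-connectivity is $\lambda_k(G)=\min\{\lambda(S): S\subseteq V(G),\ |S|=k\}$, with the convention $\lambda_k(G)=0$ if $G$ is disconnected. -}

module Defs where

open import Data.Nat using (ℕ; zero; suc; _+_; _*_; _∸_; _≤_; _<_; _<?_)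
open import Data.Bool using (Bool; true; false; _≟_)
open import Data.Fin using (Fin; toℕ)
open import Data.Fin.Subset using (Subset; _∈_; _⊆_; ∣_∣)
open import Data.List using (List; []; _∷_; _++_; [_]; length; filter; concatMap; map; allFin)
open import Data.List.Relation.Unary.Unique.Propositional using (Unique)
open import Data.List.Relation.Unary.Linked using (Linked)
open import Data.Product using (Σ; ∃; _×_; _,_; proj₁; proj₂)
open import Relation.Binary.PropositionalEquality using (_≡_)
open import Relation.Nullary using (¬_)
open import Relation.Nullary.Decidable using (_×-dec_)

record Graph (n : ℕ) : Set where
  field
    adj    : Fin n → Fin n → Bool
    sym    : ∀ i j → adj i j ≡ adj j i
    irrefl : ∀ i → adj i i ≡ false
open Graph public

pairs : (n : ℕ) → List (Fin n × Fin n)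
pairs n = concatMap (λ i → map (λ j → (i , j)) (allFin n)) (allFin n)

edgeCount : ∀ {n} → Graph n → ℕ
edgeCount {n} G =
  length (filter (λ p → (toℕ (proj₁ p) <? toℕ (proj₂ p)) ×-dec (adj G (proj₁ p) (proj₂ p) ≟ true))
                 (pairs n))

data Walk {n : ℕ} (E : Fin n → Fin n → Bool) : Fin n → Fin n → Set where
  here : ∀ {u} → Walk E u u
  step : ∀ {u w v} → E u w ≡ true → Walk E w v → Walk E u v

Connected : ∀ {n} → Graph n → Set
Connected G = ∀ u v → Walk (adj G) u v

Cycle : ∀ {n} → (Fin n → Fin n → Bool) → Set
Cycle {n} E = Σ (Fin n) λ v → Σ (List (Fin n)) λ ws →
  (2 ≤ length ws) × Unique (v ∷ ws) × Linked (λ a b → E a b ≡ true) (v ∷ ws ++ [ v ])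

record Subgraph {n : ℕ} (G : Graph n) : Set where
  field
    V     : Subset n
    E     : Fin n → Fin n → Bool
    Esym  : ∀ i j → E i j ≡ E j i
    E⊆G   : ∀ i j → E i j ≡ true → adj G i j ≡ true
    Eends : ∀ i j → E i j ≡ true → (i ∈ V) × (j ∈ V)
open Subgraph public

IsTree : ∀ {n} {G : Graph n} → Subgraph G → Set
IsTree {n} T =
  (Σ (Fin n) λ v → v ∈ V T) ×
  (∀ u v → u ∈ V T → v ∈ V T → Walk (E T) u v) ×
  ¬ Cycle (E T)

record SteinerTree {n : ℕ} (G : Graph n) (S : Subset n) : Set where
  field
    tree    : Subgraph G
    isTree  : IsTree tree
    covers  : S ⊆ V tree
open SteinerTree public

EdgeDisjoint : ∀ {n} {G : Graph n} → Subgraph G → Subgraph G → Set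
EdgeDisjoint {n} T₁ T₂ = ∀ (i j : Fin n) → E T₁ i j ≡ true → E T₂ i j ≡ false

HasDisjointSteiner : ∀ {n} → Graph n → Subset n → ℕ → Set
HasDisjointSteiner G S t =
  Σ (Fin t → SteinerTree G S) λ Ts →
    ∀ a b → ¬ a ≡ b → EdgeDisjoint (tree (Ts a)) (tree (Ts b))

IsLambda : ∀ {n} → Graph n → Subset n → ℕ → Set
IsLambda G S l = HasDisjointSteiner G S l × (∀ t → HasDisjointSteiner G S t → t ≤ l)

IsLambdaK : ∀ {n} → Graph n → ℕ → ℕ → Set
IsLambdaK {n} G k l =
  (¬ Connected G → l ≡ 0) ×
  (Connected G →
     (Σ (Subset n) λ S → (∣ S ∣ ≡ k) × IsLambda G S l) ×
     (∀ S l' → ∣ S ∣ ≡ k → IsLambda G S l' → l ≤ l'))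

-- Let q = 2m/n be the average degree. Edge-disjoint S-Steiner trees meet any vertex of S in
-- pairwise different edges, so if some vertex u has degree less than q, every k-set S containing
-- u has λ(S) ≤ deg u ≤ q - 1. Otherwise G is q-regular; put an edge uv and a third vertex w into
-- S. If no tree uses uv, every tree leaves u through one of the other q - 1 edges. If one tree
-- does, it must also leave {u, v} to reach w; at that endpoint every tree has an edge other than
-- uv, so again λ(S) + 1 ≤ q.

module Submission where

open import Defs hiding (sym)
open import Data.Nat using (ℕ; zero; suc; _+_; _*_; _∸_; _≤_; _<_; z≤n; s≤s; _≤?_; _<?_)
open import Data.Nat.Properties
  using (module ≤-Reasoning; ≤-trans; ≤-<-trans; ≤-antisym; ≤-pred; ≮⇒≥; ≰⇒>; ≤⇒≯; ≤∧≢⇒<; n≤1+n;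
         +-mono-≤; +-monoʳ-≤; +-monoˡ-≤; +-monoʳ-<; ∸-monoˡ-≤; +-suc; +-identityʳ; *-comm)
open import Data.Bool using (Bool; true) renaming (_≟_ to _≟ᵇ_)
open import Data.Fin using (Fin; zero; suc; toℕ; fromℕ<) renaming (_≟_ to _≟ᶠ_)
open import Data.Fin.Properties using (any?; injective⇒≤; <-cmp)
open import Data.Fin.Subset using (Subset; _∈_; _⊆_; ∣_∣; ⁅_⁆; _∪_; ⊤; inside; outside)
open import Data.Fin.Subset.Properties using (x∈⁅x⁆; p⊆p∪q; q⊆p∪q; ∣⊤∣≡n; ∈⊤; ∣⁅x⁆∣≡1)
open import Data.Vec.Base using ([]; _∷_; here; there)
import Data.Vec.Functional as Vector
open import Data.List
  using (List; []; _∷_; _++_; length; filter; map; allFin; concatMap; cartesianProduct; lookup)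
open import Data.Nat.ListAction using (sum)
open import Data.List.Properties using (length-++; length-map; filter-++; length-tabulate)
open import Data.List.Membership.Propositional using () renaming (_∈_ to _∈ₗ_)
open import Data.List.Membership.Propositional.Properties
  using (∈-filter⁺; ∈-filter⁻; ∈-map⁺; ∈-map⁻; ∈-++⁺ˡ; ∈-++⁺ʳ; ∈-allFin; ∈-cartesianProduct⁺; ∈-lookup)
open import Data.List.Relation.Unary.Any as Any using (index)
open import Data.List.Relation.Unary.Any.Properties using (lookup-index)
import Data.List.Relation.Unary.All as All
open import Data.List.Relation.Unary.Unique.Propositional using (Unique)
open import Data.List.Relation.Unary.AllPairs using (_∷_)
import Data.List.Relation.Unary.Unique.Propositional.Properties as Unique
open import Data.Product using (Σ; ∃; ∃₂; _×_; _,_; proj₁; proj₂; swap)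
open import Data.Sum using (_⊎_; inj₁; inj₂; [_,_])
open import Function.Base using (id; _∘_)
open import Function.Definitions using (Injective)
open import Relation.Binary.Definitions using (tri<; tri≈; tri>)
open import Relation.Nullary using (¬_; yes; no; contradiction; ¬¬-excluded-middle)
open import Relation.Nullary.Decidable using (decidable-stable; _⊎-dec_; _×-dec_)
open import Level using (0ℓ)
open import Relation.Unary using (Pred; Decidable)
open import Relation.Binary.PropositionalEquality
  using (_≡_; _≢_; refl; sym; trans; cong; cong₂; subst; module ≡-Reasoning)

private
  variable
    A : Set
    n t : ℕ

injection-into-list⇒≤ : (f : Fin t → A) → Injective _≡_ _≡_ f →
  (ys : List A) → (∀ a → f a ∈ₗ ys) → t ≤ length ys
injection-into-list⇒≤ f f-inj ys f∈ys = injective⇒≤ index-inj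
  where
  index-inj : Injective _≡_ _≡_ (λ a → index (f∈ys a))
  index-inj {a} {b} eq = f-inj (trans (lookup-index (f∈ys a))
    (trans (cong (lookup ys) eq) (sym (lookup-index (f∈ys b)))))

lookup-injective : {xs : List A} → Unique xs → Injective _≡_ _≡_ (lookup xs)
lookup-injective (x∉xs ∷ u) {zero}  {zero}  _  = refl
lookup-injective (x∉xs ∷ u) {zero}  {suc j} eq = contradiction eq (All.lookup x∉xs (∈-lookup j))
lookup-injective (x∉xs ∷ u) {suc i} {zero}  eq = contradiction (sym eq) (All.lookup x∉xs (∈-lookup i))
lookup-injective (x∉xs ∷ u) {suc i} {suc j} eq = cong suc (lookup-injective u eq)

unique-⊆⇒length-≤ : {xs ys : List A} → Unique xs → (∀ {z} → z ∈ₗ xs → z ∈ₗ ys) →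
  length xs ≤ length ys
unique-⊆⇒length-≤ {xs = xs} {ys} u xs⊆ys =
  injection-into-list⇒≤ (lookup xs) (lookup-injective u) ys (λ i → xs⊆ys (∈-lookup i))

cons-injective : {g : Fin t → A} {d : A} → Injective _≡_ _≡_ g → (∀ a → g a ≢ d) →
  Injective _≡_ _≡_ (d Vector.∷ g)
cons-injective g-inj g≢d {zero}  {zero}  _  = refl
cons-injective g-inj g≢d {zero}  {suc b} eq = contradiction (sym eq) (g≢d b)
cons-injective g-inj g≢d {suc a} {zero}  eq = contradiction eq (g≢d a)
cons-injective g-inj g≢d {suc a} {suc b} eq = cong suc (g-inj eq)

concatMap-rows≡cartesianProduct : {B : Set} (xs : List A) (ys : List B) →
  concatMap (λ i → map (i ,_) ys) xs ≡ cartesianProduct xs ys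
concatMap-rows≡cartesianProduct []       ys = refl
concatMap-rows≡cartesianProduct (x ∷ xs) ys =
  cong (map (x ,_) ys ++_) (concatMap-rows≡cartesianProduct xs ys)

module _ {q : ℕ} (f : A → ℕ) (q≤f : ∀ x → q ≤ f x) where

  sum-map-≥ : (xs : List A) → length xs * q ≤ sum (map f xs)
  sum-map-≥ []       = z≤n
  sum-map-≥ (x ∷ xs) = +-mono-≤ (q≤f x) (sum-map-≥ xs)

  sum-map-> : {xs : List A} {y : A} → y ∈ₗ xs → q < f y → length xs * q < sum (map f xs)
  sum-map-> {xs = x ∷ xs} (Any.here refl)  q<fy = +-mono-≤ q<fy (sum-map-≥ xs)
  sum-map-> {xs = x ∷ xs} (Any.there y∈xs) q<fy = begin-strict
    q + length xs * q    <⟨ +-monoʳ-< q (sum-map-> y∈xs q<fy) ⟩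
    q + sum (map f xs)   ≤⟨ +-monoˡ-≤ _ (q≤f x) ⟩
    f x + sum (map f xs) ∎
    where open ≤-Reasoning

¬¬-bounded-maximum : (P : ℕ → Set) (B : ℕ) → P 0 → (∀ t → P t → t ≤ B) →
  ¬ ¬ (∃ λ l → P l × (∀ t → P t → t ≤ l))
¬¬-bounded-maximum P zero    P0 bounded ¬max = ¬max (0 , P0 , bounded)
¬¬-bounded-maximum P (suc B) P0 bounded ¬max = ¬¬-excluded-middle λ
  { (yes P[1+B]) → ¬max (suc B , P[1+B] , bounded)
  ; (no ¬P[1+B]) → ¬¬-bounded-maximum P B P0 (below ¬P[1+B]) ¬max
  }
  where
  below : ¬ P (suc B) → ∀ t → P t → t ≤ B
  below ¬P[1+B] t Pt = ≤-pred (≤∧≢⇒< (bounded t Pt) λ { refl → ¬P[1+B] Pt })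

∣p∪q∣≤∣p∣+∣q∣ : (p q : Subset n) → ∣ p ∪ q ∣ ≤ ∣ p ∣ + ∣ q ∣
∣p∪q∣≤∣p∣+∣q∣ []            []            = z≤n
∣p∪q∣≤∣p∣+∣q∣ (inside ∷ p)  (inside ∷ q)  =
  s≤s (≤-trans (∣p∪q∣≤∣p∣+∣q∣ p q) (+-monoʳ-≤ ∣ p ∣ (n≤1+n _)))
∣p∪q∣≤∣p∣+∣q∣ (inside ∷ p)  (outside ∷ q) = s≤s (∣p∪q∣≤∣p∣+∣q∣ p q)
∣p∪q∣≤∣p∣+∣q∣ (outside ∷ p) (inside ∷ q)  =
  subst (suc ∣ p ∪ q ∣ ≤_) (sym (+-suc ∣ p ∣ ∣ q ∣)) (s≤s (∣p∪q∣≤∣p∣+∣q∣ p q))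
∣p∪q∣≤∣p∣+∣q∣ (outside ∷ p) (outside ∷ q) = ∣p∪q∣≤∣p∣+∣q∣ p q

superset-of-size : (p : Subset n) (k : ℕ) → ∣ p ∣ ≤ k → k ≤ n →
  Σ (Subset n) λ S → p ⊆ S × ∣ S ∣ ≡ k
superset-of-size []           zero    _         _         = [] , id , refl
superset-of-size (inside ∷ p) (suc k) (s≤s p≤k) (s≤s k≤n) with superset-of-size p k p≤k k≤n
... | S , p⊆S , ∣S∣≡k =
  inside ∷ S , (λ { here → here ; (there x∈p) → there (p⊆S x∈p) }) , cong suc ∣S∣≡k
superset-of-size {suc n} (outside ∷ p) k p≤k k≤1+n with k ≤? n
... | yes k≤n with superset-of-size p k p≤k k≤n
...   | S , p⊆S , ∣S∣≡k = outside ∷ S , (λ { (there x∈p) → there (p⊆S x∈p) }) , ∣S∣≡k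
superset-of-size {suc n} (outside ∷ p) k p≤k k≤1+n | no k≰n =
  ⊤ , (λ _ → ∈⊤) , trans (∣⊤∣≡n (suc n)) (≤-antisym (≰⇒> k≰n) k≤1+n)

set-of-size-containing : (a b c : Fin n) (k : ℕ) → 3 ≤ k → k ≤ n →
  Σ (Subset n) λ S → ∣ S ∣ ≡ k × a ∈ S × b ∈ S × c ∈ S
set-of-size-containing a b c k 3≤k k≤n
  with superset-of-size (⁅ a ⁆ ∪ (⁅ b ⁆ ∪ ⁅ c ⁆)) k abc≤k k≤n
  where
  abc≤k : ∣ ⁅ a ⁆ ∪ (⁅ b ⁆ ∪ ⁅ c ⁆) ∣ ≤ k
  abc≤k = begin
    ∣ ⁅ a ⁆ ∪ (⁅ b ⁆ ∪ ⁅ c ⁆) ∣         ≤⟨ ∣p∪q∣≤∣p∣+∣q∣ ⁅ a ⁆ _ ⟩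
    ∣ ⁅ a ⁆ ∣ + ∣ ⁅ b ⁆ ∪ ⁅ c ⁆ ∣        ≤⟨ +-monoʳ-≤ ∣ ⁅ a ⁆ ∣ (∣p∪q∣≤∣p∣+∣q∣ ⁅ b ⁆ ⁅ c ⁆) ⟩
    ∣ ⁅ a ⁆ ∣ + (∣ ⁅ b ⁆ ∣ + ∣ ⁅ c ⁆ ∣)  ≡⟨ cong₂ _+_ (∣⁅x⁆∣≡1 a)
                                              (cong₂ _+_ (∣⁅x⁆∣≡1 b) (∣⁅x⁆∣≡1 c)) ⟩
    3                                    ≤⟨ 3≤k ⟩
    k                                    ∎
    where open ≤-Reasoning
... | S , abc⊆S , ∣S∣≡k = S , ∣S∣≡k
  , abc⊆S (p⊆p∪q _ (x∈⁅x⁆ a))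
  , abc⊆S (q⊆p∪q ⁅ a ⁆ _ (p⊆p∪q ⁅ c ⁆ (x∈⁅x⁆ b)))
  , abc⊆S (q⊆p∪q ⁅ a ⁆ _ (q⊆p∪q ⁅ b ⁆ ⁅ c ⁆ (x∈⁅x⁆ c)))

third-vertex : 3 ≤ n → (u v : Fin n) → ∃ λ w → w ≢ u × w ≢ v
third-vertex (s≤s (s≤s (s≤s _))) zero          zero          = suc zero , (λ ()) , (λ ())
third-vertex (s≤s (s≤s (s≤s _))) zero          (suc zero)    = suc (suc zero) , (λ ()) , (λ ())
third-vertex (s≤s (s≤s (s≤s _))) zero          (suc (suc v)) = suc zero , (λ ()) , (λ ())
third-vertex (s≤s (s≤s (s≤s _))) (suc zero)    zero          = suc (suc zero) , (λ ()) , (λ ())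
third-vertex (s≤s (s≤s (s≤s _))) (suc (suc u)) zero          = suc zero , (λ ()) , (λ ())
third-vertex (s≤s (s≤s (s≤s _))) (suc u)       (suc v)       = zero , (λ ()) , (λ ())

Adjacent? : (G : Graph n) → Decidable {A = Fin n × Fin n} (λ (i , j) → adj G i j ≡ true)
Adjacent? G (i , j) = adj G i j ≟ᵇ true

row : Fin n → List (Fin n × Fin n)
row {n} i = map (i ,_) (allFin n)

-- Degrees are counted on the rows of pairs n, so that they add up to the arcs of G.
degree : Graph n → Fin n → ℕ
degree G u = length (filter (Adjacent? G) (row u))

injective-neighbours⇒≤-degree : (G : Graph n) (c : Fin n) (g : Fin t → Fin n) →
  Injective _≡_ _≡_ g → (∀ a → adj G c (g a) ≡ true) → t ≤ degree G c
injective-neighbours⇒≤-degree G c g g-inj c~g =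
  injection-into-list⇒≤ (λ a → c , g a) (λ eq → g-inj (cong proj₂ eq)) _
    (λ a → ∈-filter⁺ (Adjacent? G) (∈-map⁺ (c ,_) (∈-allFin (g a))) (c~g a))

neighbour-of-positive-degree : (G : Graph n) (u : Fin n) → 0 < degree G u →
  ∃ λ v → adj G u v ≡ true
neighbour-of-positive-degree G u pos
  with ∈-filter⁻ (Adjacent? G) {xs = row u} (∈-lookup (fromℕ< pos))
... | arc∈row , u~v with ∈-map⁻ (u ,_) arc∈row
... | v , _ , arc≡uv = v , subst (λ (i , j) → adj G i j ≡ true) arc≡uv u~v

pairs≡cartesianProduct : ∀ n → pairs n ≡ cartesianProduct (allFin n) (allFin n)
pairs≡cartesianProduct n = concatMap-rows≡cartesianProduct (allFin n) (allFin n)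

pairs-unique : ∀ n → Unique (pairs n)
pairs-unique n = subst Unique (sym (pairs≡cartesianProduct n))
  (Unique.cartesianProduct⁺ (Unique.allFin⁺ n) (Unique.allFin⁺ n))

∈-pairs : (i j : Fin n) → (i , j) ∈ₗ pairs n
∈-pairs {n} i j = subst ((i , j) ∈ₗ_) (sym (pairs≡cartesianProduct n))
  (∈-cartesianProduct⁺ (∈-allFin i) (∈-allFin j))

sum-degree≡arcs : (G : Graph n) (xs : List (Fin n)) →
  sum (map (degree G) xs) ≡ length (filter (Adjacent? G) (concatMap row xs))
sum-degree≡arcs G []       = refl
sum-degree≡arcs G (x ∷ xs) = sym (begin
  length (filter (Adjacent? G) (row x ++ concatMap row xs))
    ≡⟨ cong length (filter-++ (Adjacent? G) (row x) (concatMap row xs)) ⟩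
  length (filter (Adjacent? G) (row x) ++ filter (Adjacent? G) (concatMap row xs))
    ≡⟨ length-++ (filter (Adjacent? G) (row x)) ⟩
  degree G x + length (filter (Adjacent? G) (concatMap row xs))
    ≡⟨ cong (degree G x +_) (sym (sum-degree≡arcs G xs)) ⟩
  degree G x + sum (map (degree G) xs) ∎)
  where open ≡-Reasoning

-- Every arc (i , j) is an edge i < j counted by edgeCount, or the reverse of one.
sum-degree≤2*edgeCount : (G : Graph n) → sum (map (degree G) (allFin n)) ≤ 2 * edgeCount G
sum-degree≤2*edgeCount {n} G = begin
  sum (map (degree G) (allFin n))
    ≡⟨ sum-degree≡arcs G (allFin n) ⟩
  length (filter (Adjacent? G) (pairs n))
    ≤⟨ unique-⊆⇒length-≤ (Unique.filter⁺ (Adjacent? G) (pairs-unique n)) arc∈edges ⟩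
  length (edges ++ map swap edges)
    ≡⟨ length-++ edges ⟩
  length edges + length (map swap edges)
    ≡⟨ cong (length edges +_) (trans (length-map swap edges) (sym (+-identityʳ _))) ⟩
  2 * edgeCount G ∎
  where
  open ≤-Reasoning
  Edge? : Decidable {A = Fin n × Fin n} (λ (i , j) → (toℕ i < toℕ j) × adj G i j ≡ true)
  Edge? (i , j) = (toℕ i <? toℕ j) ×-dec Adjacent? G (i , j)
  edges : List (Fin n × Fin n)
  edges = filter Edge? (pairs n)
  arc∈edges : ∀ {p} → p ∈ₗ filter (Adjacent? G) (pairs n) → p ∈ₗ edges ++ map swap edges
  arc∈edges {i , j} arc with ∈-filter⁻ (Adjacent? G) {xs = pairs n} arc
  ... | ij∈pairs , i~j with <-cmp i j
  ... | tri< i<j _ _ = ∈-++⁺ˡ (∈-filter⁺ Edge? ij∈pairs (i<j , i~j))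
  ... | tri> _ _ j<i =
    ∈-++⁺ʳ edges (∈-map⁺ swap (∈-filter⁺ Edge? (∈-pairs j i) (j<i , trans (Graph.sym G j i) i~j)))
  ... | tri≈ _ refl _ = contradiction (trans (sym i~j) (irrefl G i)) λ ()

min-degree≥average⇒regular : (G : Graph n) (q : ℕ) → 2 * edgeCount G ≡ q * n →
  (∀ u → q ≤ degree G u) → ∀ u → degree G u ≤ q
min-degree≥average⇒regular {n} G q avg q≤deg u with degree G u ≤? q
... | yes deg≤q = deg≤q
... | no deg≰q = contradiction (sum-map-> (degree G) q≤deg (∈-allFin u) (≰⇒> deg≰q)) (≤⇒≯ (begin
  sum (map (degree G) (allFin n)) ≤⟨ sum-degree≤2*edgeCount G ⟩
  2 * edgeCount G                 ≡⟨ avg ⟩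
  q * n                           ≡⟨ *-comm q n ⟩
  n * q                           ≡⟨ cong (_* q) (sym (length-tabulate {n = n} id)) ⟩
  length (allFin n) * q           ∎))
  where open ≤-Reasoning

module _ {F : Fin n → Fin n → Bool} where

  walk-first-edge : ∀ {u w} → Walk F u w → w ≢ u → ∃ λ x → F u x ≡ true
  walk-first-edge here       w≢u = contradiction refl w≢u
  walk-first-edge (step e _) _ = _ , e

  walk-crosses : {P : Pred (Fin n) 0ℓ} → Decidable P → ∀ {z w} → Walk F z w → P z → ¬ P w →
    ∃₂ λ y x → P y × F y x ≡ true × ¬ P x
  walk-crosses P? here                  Pz ¬Pw = contradiction Pz ¬Pw
  walk-crosses P? (step {w = x} e rest) Pz ¬Pw with P? x
  ... | yes Px = walk-crosses P? rest Px ¬Pw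
  ... | no ¬Px = _ , x , Pz , e , ¬Px

no-shared-edge : {G : Graph n} {T U : Subgraph G} → EdgeDisjoint T U →
  ∀ {i j} → E T i j ≡ true → E U i j ≢ true
no-shared-edge T∩U=∅ {i} {j} i~j∈T i~j∈U with trans (sym (T∩U=∅ i j i~j∈T)) i~j∈U
... | ()

PairwiseEdgeDisjoint : {G : Graph n} → (Fin t → Subgraph G) → Set
PairwiseEdgeDisjoint T = ∀ a b → a ≢ b → EdgeDisjoint (T a) (T b)

module _ {G : Graph n} (T : Fin t → Subgraph G) (disjoint : PairwiseEdgeDisjoint T) (c : Fin n)
  where

  private
    choice-injective : (g : Fin t → Fin n) → (∀ a → E (T a) c (g a) ≡ true) → Injective _≡_ _≡_ g
    choice-injective g c~g {a} {b} ga≡gb with a ≟ᶠ b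
    ... | yes a≡b = a≡b
    ... | no a≢b = contradiction (subst (λ x → E (T b) c x ≡ true) (sym ga≡gb) (c~g b))
                                 (no-shared-edge {T = T a} {U = T b} (disjoint a b a≢b) (c~g a))

  edges-at⇒≤-degree : (∀ a → ∃ λ x → E (T a) c x ≡ true) → t ≤ degree G c
  edges-at⇒≤-degree edge = injective-neighbours⇒≤-degree G c (proj₁ ∘ edge)
    (choice-injective (proj₁ ∘ edge) (proj₂ ∘ edge)) (λ a → E⊆G (T a) c _ (proj₂ (edge a)))

  edges-at-avoiding⇒<-degree : ∀ {d} → adj G c d ≡ true →
    (∀ a → ∃ λ x → E (T a) c x ≡ true × x ≢ d) → t < degree G c
  edges-at-avoiding⇒<-degree {d} c~d edge =
    injective-neighbours⇒≤-degree G c (d Vector.∷ proj₁ ∘ edge)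
    (cons-injective (choice-injective (proj₁ ∘ edge) (proj₁ ∘ proj₂ ∘ edge)) (proj₂ ∘ proj₂ ∘ edge))
    λ { zero → c~d ; (suc a) → E⊆G (T a) c _ (proj₁ (proj₂ (edge a))) }

steiner-walk : {G : Graph n} {S : Subset n} (T : SteinerTree G S) →
  ∀ {u w} → u ∈ S → w ∈ S → Walk (E (tree T)) u w
steiner-walk T u∈S w∈S = proj₁ (proj₂ (isTree T)) _ _ (covers T u∈S) (covers T w∈S)

module _ {G : Graph n} {S : Subset n} (Ts : Fin t → SteinerTree G S)
         (disjoint : PairwiseEdgeDisjoint (tree ∘ Ts)) {w : Fin n} (w∈S : w ∈ S) where

  edges-towards : ∀ {c} → c ∈ S → w ≢ c → ∀ a → ∃ λ x → E (tree (Ts a)) c x ≡ true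
  edges-towards c∈S w≢c a = walk-first-edge (steiner-walk (Ts a) c∈S w∈S) w≢c

  edges-avoiding-used-edge : ∀ {c d} → c ∈ S → w ≢ c → (a* : Fin t) → E (tree (Ts a*)) c d ≡ true →
    (∃ λ x → E (tree (Ts a*)) c x ≡ true × x ≢ d) →
    ∀ a → ∃ λ x → E (tree (Ts a)) c x ≡ true × x ≢ d
  edges-avoiding-used-edge c∈S w≢c a* cd∈a* edge* a with a ≟ᶠ a*
  ... | yes refl = edge*
  ... | no a≢a* with edges-towards c∈S w≢c a
  ... | x , cx∈a = x , cx∈a , λ { refl →
    no-shared-edge {T = tree (Ts a*)} {U = tree (Ts a)} (disjoint a* a (a≢a* ∘ sym)) cd∈a* cx∈a }

disjoint-steiner-≤-degree : {G : Graph n} {S : Subset n} {u w : Fin n} →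
  u ∈ S → w ∈ S → w ≢ u → HasDisjointSteiner G S t → t ≤ degree G u
disjoint-steiner-≤-degree {u = u} u∈S w∈S w≢u (Ts , disjoint) =
  edges-at⇒≤-degree (tree ∘ Ts) disjoint u (edges-towards Ts disjoint w∈S u∈S w≢u)

disjoint-steiner-<-degree : {G : Graph n} {S : Subset n} {u v w : Fin n} → adj G u v ≡ true →
  u ∈ S → v ∈ S → w ∈ S → w ≢ u → w ≢ v → HasDisjointSteiner G S t →
  t < degree G u ⊎ t < degree G v
disjoint-steiner-<-degree {G = G} {u = u} {v} u~v u∈S v∈S w∈S w≢u w≢v (Ts , disjoint)
  with any? (λ a → E (tree (Ts a)) u v ≟ᵇ true)
... | no uv-unused = inj₁ (edges-at-avoiding⇒<-degree (tree ∘ Ts) disjoint u u~v avoiding-v)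
  where
  avoiding-v : ∀ a → ∃ λ x → E (tree (Ts a)) u x ≡ true × x ≢ v
  avoiding-v a with edges-towards Ts disjoint w∈S u∈S w≢u a
  ... | x , ux∈a = x , ux∈a , λ { refl → uv-unused (a , ux∈a) }
... | yes (a* , uv∈a*)
  with walk-crosses (λ x → (x ≟ᶠ u) ⊎-dec (x ≟ᶠ v)) (steiner-walk (Ts a*) u∈S w∈S)
                    (inj₁ refl) [ w≢u , w≢v ]
... | _ , x , inj₁ refl , ux∈a* , x∉uv =
  inj₁ (edges-at-avoiding⇒<-degree (tree ∘ Ts) disjoint u u~v
    (edges-avoiding-used-edge Ts disjoint w∈S u∈S w≢u a* uv∈a* (x , ux∈a* , x∉uv ∘ inj₂)))
... | _ , x , inj₂ refl , vx∈a* , x∉uv =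
  inj₂ (edges-at-avoiding⇒<-degree (tree ∘ Ts) disjoint v (trans (Graph.sym G v u) u~v)
    (edges-avoiding-used-edge Ts disjoint w∈S v∈S w≢v a* (trans (Esym (tree (Ts a*)) v u) uv∈a*)
      (x , vx∈a* , x∉uv ∘ inj₁)))

-- λ(S) ≤ B, phrased without presupposing that the maximum λ(S) exists.
DisjointSteinerBound : Graph n → Subset n → ℕ → Set
DisjointSteinerBound G S B = ∀ t → HasDisjointSteiner G S t → t ≤ B

module _ (G : Graph n) {k : ℕ} (3≤k : 3 ≤ k) (k≤n : k ≤ n) {q : ℕ} where

  private
    3≤n : 3 ≤ n
    3≤n = ≤-trans 3≤k k≤n

    <⇒≤∸1 : ∀ {t} → t < q → t ≤ q ∸ 1
    <⇒≤∸1 = ∸-monoˡ-≤ 1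

    containing : (a b c : Fin n) →
      (∀ {S} → a ∈ S → b ∈ S → c ∈ S → DisjointSteinerBound G S (q ∸ 1)) →
      Σ (Subset n) λ S → ∣ S ∣ ≡ k × DisjointSteinerBound G S (q ∸ 1)
    containing a b c bound with set-of-size-containing a b c k 3≤k k≤n
    ... | S , ∣S∣≡k , a∈S , b∈S , c∈S = S , ∣S∣≡k , bound a∈S b∈S c∈S

  low-degree⇒bounded-set : (u : Fin n) → degree G u < q →
    Σ (Subset n) λ S → ∣ S ∣ ≡ k × DisjointSteinerBound G S (q ∸ 1)
  low-degree⇒bounded-set u deg<q with third-vertex 3≤n u u
  ... | w , w≢u , _ = containing u w w λ u∈S w∈S _ t trees →
    <⇒≤∸1 (≤-<-trans (disjoint-steiner-≤-degree u∈S w∈S w≢u trees) deg<q)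

  isolated-vertex⇒bounded-set : (u : Fin n) → ¬ 0 < degree G u →
    Σ (Subset n) λ S → ∣ S ∣ ≡ k × DisjointSteinerBound G S (q ∸ 1)
  isolated-vertex⇒bounded-set u deg≯0 with third-vertex 3≤n u u
  ... | w , w≢u , _ = containing u w w λ u∈S w∈S _ t trees →
    ≤-trans (≤-trans (disjoint-steiner-≤-degree u∈S w∈S w≢u trees) (≮⇒≥ deg≯0)) z≤n

  regular⇒bounded-set : (∀ u → degree G u ≤ q) → ∀ {u v} → adj G u v ≡ true →
    Σ (Subset n) λ S → ∣ S ∣ ≡ k × DisjointSteinerBound G S (q ∸ 1)
  regular⇒bounded-set regular {u} {v} u~v with third-vertex 3≤n u v
  ... | w , w≢u , w≢v = containing u v w λ u∈S v∈S w∈S t trees →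
    [ (λ t<deg → <⇒≤∸1 (≤-trans t<deg (regular u)))
    , (λ t<deg → <⇒≤∸1 (≤-trans t<deg (regular v))) ]
      (disjoint-steiner-<-degree u~v u∈S v∈S w∈S w≢u w≢v trees)

set-of-size-with-bounded-disjoint-steiner-trees : (G : Graph n) (k q : ℕ) → 3 ≤ k → k ≤ n →
  2 * edgeCount G ≡ q * n → Σ (Subset n) λ S → ∣ S ∣ ≡ k × DisjointSteinerBound G S (q ∸ 1)
set-of-size-with-bounded-disjoint-steiner-trees G k q 3≤k k≤n avg with ≤-trans 3≤k k≤n
... | s≤s _ with any? (λ u → degree G u <? q)
... | yes (u , deg<q) = low-degree⇒bounded-set G 3≤k k≤n u deg<q
... | no no-low-degree with 0 <? degree G zero
...   | no deg≯0 = isolated-vertex⇒bounded-set G 3≤k k≤n {q} zero deg≯0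
...   | yes deg>0 =
  regular⇒bounded-set G 3≤k k≤n regular (proj₂ (neighbour-of-positive-degree G zero deg>0))
  where
  regular : ∀ u → degree G u ≤ q
  regular = min-degree≥average⇒regular G q avg (λ u → ≮⇒≥ (λ deg<q → no-low-degree (u , deg<q)))

-- λ(S) exists only classically, which is harmless because the goal l ≤ B is decidable.
IsLambdaK⇒≤ : {G : Graph n} {k l B : ℕ} → IsLambdaK G k l →
  (S : Subset n) → ∣ S ∣ ≡ k → DisjointSteinerBound G S B → l ≤ B
IsLambdaK⇒≤ {G = G} {l = l} {B} (disconnected⇒0 , connected⇒min) S ∣S∣≡k bound =
  decidable-stable (l ≤? B) λ l≰B → ¬¬-excluded-middle λ
    { (no disconnected) → l≰B (subst (_≤ B) (sym (disconnected⇒0 disconnected)) z≤n)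
    ; (yes connected) → ¬¬-bounded-maximum (HasDisjointSteiner G S) B ((λ ()) , (λ ())) bound
        λ (λS , has , max) →
          l≰B (≤-trans (proj₂ (connected⇒min connected) S λS ∣S∣≡k (has , max)) (bound λS has))
    }

corollary3 : ∀ (n : ℕ) (G : Graph n) (k : ℕ) →
    n ∸ 1 ≤ edgeCount G → 3 ≤ k → k ≤ n →
    ∀ (q : ℕ) → 2 * edgeCount G ≡ q * n →
    ∀ (l : ℕ) → IsLambdaK G k l → l ≤ q ∸ 1
corollary3 n G k _ 3≤k k≤n q avg l λk
  with set-of-size-with-bounded-disjoint-steiner-trees G k q 3≤k k≤n avg
... | S , ∣S∣≡k , bound = IsLambdaK⇒≤ λk S ∣S∣≡k bound
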